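{- Let $G_D=([m],E_D)$ be a graph and $\mathcal M\subseteq E_D$ a matching. The map $h$ is an injection from $\{(D,\mathscr S): D\in\mathcal D(G_D),\ \mathscr S\in\psi(D)\}$ into $\mathcal D(G^{\mathcal M})$.
   Context: Wdag of a graph $G$ (vertex set $W$): finite DAG with labels in $W$ such that distinct nodes are joined by an arc (either direction) iff their labels are equal or adjacent in $G$; proper if it has exactly one sink; $\mathcal D(G)$ is the set of proper wdags of $G$ (up to isomorphism of labelled DAGs). $G^{\mathcal M}=(V^{\mathcal M},E^{\mathcal M})$: vertices are the $\mathcal M$-unmatched $i\in[m]$ plus $i^\uparrow,i^\downarrow$ for each matched $i$; for every $(i_0,i_1)\in E_D$, every two distinct vertices of $\{i_0,i_1,i_0^\uparrow,i_0^\downarrow,i_1^\uparrow,i_1^\downarrow\}\cap V^{\mathcal M}$ are adjacent. For a proper wdag $D=(V,E,L)$ of $G_D$: an arc $u\to v$ is $\mathcal M$-reversible if reversing it yields a DAG and $(L(u),L(v))\in\mathcal M$; $\mathcal V(D)$ is the set of nodes incident to an $\mathcal M$-reversible arc; $\mathscr M(D)=\{v: L(v)\text{ is an endpoint of an edge of }\mathcal M\}$. $\psi(D)$ is the set of quadruples $\mathscr S=(\mathscr S_1,\mathscr S_2,\mathscr S_3,\mathscr S_4)$ of pairwise disjoint (possibly empty) sets with union $\mathscr M(D)$ and $\mathcal V(D)\subseteq\mathscr S_1$. For each $D$ a topological ordering $\pi_D$ is fixed. Definition of $h(D,\mathscr S)=D'=(V',E',L')$: $V'=V_1'\sqcup V_2'$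 with bijections $f:V\to V_1'$, $f^*:\mathscr S_3\cup\mathscr S_4\to V_2'$; for $v'\in V'$, $g(v')$ is the $v\in V$ with $f(v)=v'$ or $f^*(v)=v'$. Labels: for $v\in V$, $L'(f(v))=L(v)^\uparrow$ if $v\in\mathscr S_1$, $L(v)^\downarrow$ if $v\in\mathscr S_2\cup\mathscr S_3\cup\mathscr S_4$, and $L(v)$ if $v\notin\mathscr M(D)$; for $v\in\mathscr S_3\cup\mathscr S_4$ with $(L(v),i)\in\mathcal M$, $L'(f^*(v))=i^\uparrow$ if $v\in\mathscr S_3$ and $i^\downarrow$ if $v\in\mathscr S_4$. Arcs: $E'=E_1'\sqcup E_2'$ with $E_1'=\{f^*(v)\to f(v):v\in\mathscr S_3\cup\mathscr S_4\}$ and $E_2'=\{u'\to v': (L'(u')=L'(v')\text{ or }(L'(u'),L'(v'))\in E^{\mathcal M})\text{ and }g(u')\text{ precedes }g(v')\text{ strictly in }\pi_D\}$. -}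

module Defs where

open import Data.Nat using (ℕ; zero; suc)
open import Data.Fin using (Fin; zero; suc; _<_)
open import Data.Bool using (Bool; true; false; if_then_else_; _∨_; _∧_)
open import Data.Maybe using (Maybe; just; nothing; maybe)
open import Data.Product using (Σ; ∃; _×_; _,_; proj₁; proj₂)
open import Data.Sum using (_⊎_; inj₁; inj₂)
open import Data.Empty using (⊥)
open import Data.Unit using (⊤)
open import Relation.Nullary using (¬_)
open import Relation.Binary.PropositionalEquality using (_≡_; _≢_)
open import Relation.Binary.Construct.Closure.Transitive using (TransClosure)
open import Function.Bundles using (_↔_; _⇔_; Inverse)

record Graph (W : Set) : Set₁ where
  field
    InV : W → Set
    Adj : W → W → Set
open Graph public

-- The graph G_D = ([m], E_D), with E_D given by a Boolean
-- characteristic function (symmetric, irreflexive: a simple graph).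
GD : {m : ℕ} → (Fin m → Fin m → Bool) → Graph (Fin m)
GD E = record { InV = λ _ → ⊤ ; Adj = λ i j → E i j ≡ true }

record IsMatching {m : ℕ} (E M : Fin m → Fin m → Bool) : Set where
  field
    sub   : ∀ i j → M i j ≡ true → E i j ≡ true
    sym   : ∀ i j → M i j ≡ true → M j i ≡ true
    match : ∀ i j k → M i j ≡ true → M i k ≡ true → j ≡ k

Matched : {m : ℕ} → (Fin m → Fin m → Bool) → Fin m → Set
Matched M i = Σ _ λ j → M i j ≡ true

-- plain i  ~  i  (for unmatched i);  up i ~ i↑ ;  down i ~ i↓
data Lab (m : ℕ) : Set where
  plain up down : Fin m → Lab m

base : {m : ℕ} → Lab m → Fin m
base (plain i) = i
base (up i)    = i
base (down i)  = i

InVM : {m : ℕ} → (Fin m → Fin m → Bool) → Lab m → Set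
InVM M (plain i) = ¬ Matched M i
InVM M (up i)    = Matched M i
InVM M (down i)  = Matched M i

AdjM : {m : ℕ} → (E M : Fin m → Fin m → Bool) → Lab m → Lab m → Set
AdjM E M x y =
  x ≢ y × InVM M x × InVM M y ×
  Σ _ λ i₀ → Σ _ λ i₁ → E i₀ i₁ ≡ true ×
    (base x ≡ i₀ ⊎ base x ≡ i₁) × (base y ≡ i₀ ⊎ base y ≡ i₁)

GM : {m : ℕ} → (E M : Fin m → Fin m → Bool) → Graph (Lab m)
GM E M = record { InV = InVM M ; Adj = AdjM E M }

record LDigraph (W : Set) : Set₁ where
  field
    node : Set
    arc  : node → node → Set
    lab  : node → W
open LDigraph public

IsFinite : Set → Set
IsFinite A = Σ ℕ λ n → A ↔ Fin n

Acyclic : {A : Set} → (A → A → Set) → Set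
Acyclic {A} R = (v : A) → ¬ TransClosure R v v

record IsWdag {W : Set} (G : Graph W) (D : LDigraph W) : Set where
  field
    finite  : IsFinite (node D)
    acyclic : Acyclic (arc D)
    labIn   : ∀ v → InV G (lab D v)
    arcIff  : ∀ u v → u ≢ v →
              (arc D u v ⊎ arc D v u) ⇔ (lab D u ≡ lab D v ⊎ Adj G (lab D u) (lab D v))

IsSink : {W : Set} (D : LDigraph W) → node D → Set
IsSink D v = ∀ w → ¬ arc D v w

record IsProperWdag {W : Set} (G : Graph W) (D : LDigraph W) : Set where
  field
    wdag    : IsWdag G D
    sink    : node D
    isSink  : IsSink D sink
    unique  : ∀ w → IsSink D w → w ≡ sink

record Iso {W : Set} (D₁ D₂ : LDigraph W) : Set where
  field
    φ      : node D₁ ↔ node D₂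
    arcPres : ∀ u v → arc D₁ u v ⇔ arc D₂ (Inverse.to φ u) (Inverse.to φ v)
    labPres : ∀ u → lab D₂ (Inverse.to φ u) ≡ lab D₁ u

record TopOrd {W : Set} (D : LDigraph W) : Set where
  field
    size : ℕ
    ord  : node D ↔ Fin size
    resp : ∀ u v → arc D u v → Inverse.to ord u < Inverse.to ord v
open TopOrd public

precedes : {W : Set} {D : LDigraph W} → TopOrd D → node D → node D → Set
precedes π u v = Inverse.to (ord π) u < Inverse.to (ord π) v

reverseArc : {A : Set} → (A → A → Set) → A → A → (A → A → Set)
reverseArc R u v x y = (R x y × ¬ (x ≡ u × y ≡ v)) ⊎ (x ≡ v × y ≡ u)

Reversible : {m : ℕ} → (M : Fin m → Fin m → Bool) → (D : LDigraph (Fin m)) →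
             node D → node D → Set
Reversible M D u v =
  arc D u v × Acyclic (reverseArc (arc D) u v) × M (lab D u) (lab D v) ≡ true

InV𝒱 : {m : ℕ} → (M : Fin m → Fin m → Bool) → (D : LDigraph (Fin m)) → node D → Set
InV𝒱 M D v = Σ (node D) λ w → Reversible M D v w ⊎ Reversible M D w v

In𝓜 : {m : ℕ} → (M : Fin m → Fin m → Bool) → (D : LDigraph (Fin m)) → node D → Set
In𝓜 M D v = Matched M (lab D v)

record Quad (A : Set) : Set where
  field
    S₁ S₂ S₃ S₄ : A → Bool
open Quad public

Disjoint : {A : Set} → (A → Bool) → (A → Bool) → Set
Disjoint P Q = ∀ v → P v ≡ true → Q v ≡ true → ⊥

record InPsi {m : ℕ} (M : Fin m → Fin m → Bool) (D : LDigraph (Fin m))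
             (S : Quad (node D)) : Set where
  field
    d12 : Disjoint (S₁ S) (S₂ S)
    d13 : Disjoint (S₁ S) (S₃ S)
    d14 : Disjoint (S₁ S) (S₄ S)
    d23 : Disjoint (S₂ S) (S₃ S)
    d24 : Disjoint (S₂ S) (S₄ S)
    d34 : Disjoint (S₃ S) (S₄ S)
    union : ∀ v → ((S₁ S v ∨ S₂ S v ∨ S₃ S v ∨ S₄ S v) ≡ true) ⇔ In𝓜 M D v
    V⊆S₁  : ∀ v → InV𝒱 M D v → S₁ S v ≡ true

-- first j with P j, if any (for a matching: the unique M-partner)
findFin : {n : ℕ} → (Fin n → Bool) → Maybe (Fin n)
findFin {zero}  P = nothing
findFin {suc n} P = if P zero then just zero else Data.Maybe.map suc (findFin (λ j → P (suc j)))

-- V' = V₁' ⊔ V₂' with V₁' = f(V) and V₂' = f*(𝒮₃ ∪ 𝒮₄)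
hNode : {A : Set} → Quad A → Set
hNode {A} S = A ⊎ Σ A (λ v → (S₃ S v ∨ S₄ S v) ≡ true)

hg : {A : Set} (S : Quad A) → hNode S → A
hg S (inj₁ v)       = v
hg S (inj₂ (v , _)) = v

hLab : {m : ℕ} (M : Fin m → Fin m → Bool) (D : LDigraph (Fin m)) (S : Quad (node D)) →
       hNode S → Lab m
hLab M D S (inj₁ v) =
  if S₁ S v then up (lab D v)
  else if (S₂ S v ∨ S₃ S v ∨ S₄ S v) then down (lab D v)
  else plain (lab D v)
hLab M D S (inj₂ (v , _)) =
  maybe (λ i → if S₃ S v then up i else down i) (plain (lab D v))
        (findFin (M (lab D v)))

hE₁ : {A : Set} (S : Quad A) → hNode S → hNode S → Set
hE₁ S (inj₂ (v , _)) (inj₁ w) = v ≡ w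
hE₁ S _ _ = ⊥

h : {m : ℕ} (E M : Fin m → Fin m → Bool) (D : LDigraph (Fin m)) →
    TopOrd D → Quad (node D) → LDigraph (Lab m)
h E M D π S = record
  { node = hNode S
  ; arc  = λ u' v' →
      hE₁ S u' v' ⊎
      ((hLab M D S u' ≡ hLab M D S v' ⊎ AdjM E M (hLab M D S u') (hLab M D S v'))
        × precedes π (hg S u') (hg S v'))
  ; lab  = hLab M D S
  }

record PairIso {m : ℕ} (D₁ D₂ : LDigraph (Fin m)) (S : Quad (node D₁)) (T : Quad (node D₂)) : Set where
  field
    iso : Iso D₁ D₂
    p₁ : ∀ v → S₁ T (Inverse.to (Iso.φ iso) v) ≡ S₁ S v
    p₂ : ∀ v → S₂ T (Inverse.to (Iso.φ iso) v) ≡ S₂ S v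
    p₃ : ∀ v → S₃ T (Inverse.to (Iso.φ iso) v) ≡ S₃ S v
    p₄ : ∀ v → S₄ T (Inverse.to (Iso.φ iso) v) ≡ S₄ S v

-- Write f(v) = inj₁ v and f*(v) = inj₂ (v , _) for the nodes of h(D,𝒮).
--
-- Properness: the rank 2·π(v) of f*(v) and 2·π(v)+1 of f(v) strictly increases along arcs, so
-- h(D,𝒮) is acyclic, and f of the π-last node (the sink of D) is its unique sink.
--
-- Injectivity: call x → y a twin arc if it is a covering arc, y is labelled ↓ and the labels of
-- x and y lie over M-partners. Each f*(v) → f(v) is a twin arc; a twin arc out of f*(u) can only
-- end at f(u), and there is no twin arc f(w) → f(v). So twin arcs always join f(D) with its
-- complement. Twin arcs are invariant under isomorphism, hence a node moved by an isomorphism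
-- h(D₁,𝒮) ≅ h(D₂,𝒯) to the other side has a twin arc to another such node, an infinite ascent in
-- a finite DAG. The isomorphism thus restricts to D₁ ≅ D₂ and maps f* to f*, and the labels
-- ↑/↓ of f(v) and f*(v) recover 𝒮.

module Submission where

open import Defs
open import Data.Nat as ℕ using (ℕ; suc; _+_; _*_; _∸_; s≤s)
import Data.Nat.Properties as ℕ
open import Data.Nat.Induction using (<-wellFounded)
open import Data.Fin as Fin using (Fin; zero; suc; toℕ)
import Data.Fin.Properties as Fin
open import Data.Bool using (Bool; true; false; if_then_else_; _∨_; _∧_; not)
import Data.Bool as Bool
open import Data.Bool.Properties using (¬-not; not-injective; ⇔→≡)
open import Data.Maybe using (just)
import Data.Maybe as Maybe
open import Data.Product using (Σ; ∃-syntax; _×_; _,_; proj₁; proj₂)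
open import Data.Product.Function.Dependent.Propositional using (Σ-↔)
open import Data.Sum using (_⊎_; inj₁; inj₂; [_,_]′)
open import Data.Sum.Properties using (inj₁-injective)
open import Data.Sum.Function.Propositional using (_⊎-↔_)
open import Data.Empty using (⊥; ⊥-elim)
open import Function using (_∘_; id; flip; case_of_)
open import Function.Bundles using (_↔_; _⇔_; Inverse; Injection; Equivalence; mk⇔; mk↔ₛ′)
open import Function.Properties.Inverse using (↔-sym; ↔-trans; ↔⇒↣)
open import Function.Related.Propositional using (K-reflexive)
open import Induction.WellFounded using (WellFounded; module Subrelation)
import Relation.Binary.Construct.On as On
open import Relation.Nullary using (¬_)
open import Relation.Nullary.Decidable using (decidable-stable)
open import Induction.InfiniteDescent using (descent∧wf⇒empty)
open import Relation.Binary.Definitions using (tri<; tri≈; tri>)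
open import Axiom.UniquenessOfIdentityProofs using (module Decidable⇒UIP)
open import Relation.Binary.PropositionalEquality using (_≡_; _≢_; refl; sym; trans; cong; cong₂; subst; subst₂; module ≡-Reasoning)
open import Relation.Binary.Construct.Closure.Transitive using (TransClosure; [_]; _∷_)
open import Relation.Binary.Construct.Closure.ReflexiveTransitive as Star using (Star; ε; _◅_; _◅◅_)

module _ {A : Set} {R : A → A → Set} where

  map⁺ : {B : Set} {Q : B → B → Set} {f : A → B} → (∀ {x y} → R x y → Q (f x) (f y)) →
         ∀ {x y} → TransClosure R x y → TransClosure Q (f x) (f y)
  map⁺ g [ r ]    = [ g r ]
  map⁺ g (r ∷ rs) = g r ∷ map⁺ g rs

  Star⇒TransClosure : ∀ {x y z} → R x y → Star R y z → TransClosure R x z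
  Star⇒TransClosure r ε        = [ r ]
  Star⇒TransClosure r (s ◅ ss) = r ∷ Star⇒TransClosure s ss

  TransClosure⇒Star : ∀ {x y} → TransClosure R x y → Star R x y
  TransClosure⇒Star [ r ]    = r ◅ ε
  TransClosure⇒Star (r ∷ rs) = r ◅ TransClosure⇒Star rs

NoDetour : {A : Set} → (A → A → Set) → A → A → Set
NoDetour R x y = ∀ z → R x z → ¬ TransClosure R z y

module _ {A : Set} {R : A → A → Set} {w v : A} where

  private
    R′ = reverseArc R w v
    Kept : A → A → Set
    Kept x y = R x y × ¬ (x ≡ w × y ≡ v)

  lastReversal : ∀ {a b} → TransClosure R′ a b →
                 TransClosure Kept a b ⊎ (Star R′ a v × Star Kept w b)
  lastReversal [ inj₁ k ]            = inj₁ [ k ]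
  lastReversal [ inj₂ (refl , refl) ] = inj₂ (ε , ε)
  lastReversal (r ∷ rs) with lastReversal rs
  ... | inj₂ (pre , post)                    = inj₂ (r ◅ pre , post)
  lastReversal (inj₁ k ∷ rs)            | inj₁ kept = inj₁ (k ∷ kept)
  lastReversal (inj₂ (refl , refl) ∷ rs) | inj₁ kept = inj₂ (ε , TransClosure⇒Star kept)

  -- A cycle must use the reversed arc v → w, so it contains a path w ⇝ v; the part of that
  -- path after its last reversed arc is an R-path w ⇝ v other than the arc w → v: a detour.
  reverseArc-acyclic : Acyclic R → R w v → NoDetour R w v → Acyclic R′
  reverseArc-acyclic acyclic wv noDetour c cycle with lastReversal cycle
  ... | inj₁ kept         = acyclic c (map⁺ proj₁ kept)
  ... | inj₂ (pre , post) = no-kept-w⇝v (kept-w⇝v (Star.gmap id inj₁ post ◅◅ pre))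
    where
    kept-w⇝v : Star R′ w v → Star Kept w v
    kept-w⇝v ε        = ε
    kept-w⇝v (r ◅ rs) with lastReversal (Star⇒TransClosure r rs)
    ... | inj₁ kept        = TransClosure⇒Star kept
    ... | inj₂ (_ , post′) = post′
    no-kept-w⇝v : Star Kept w v → ⊥
    no-kept-w⇝v ε             = acyclic w [ wv ]
    no-kept-w⇝v (k ◅ ε)       = proj₂ k (refl , refl)
    no-kept-w⇝v (k ◅ k′ ◅ ks) =
      noDetour _ (proj₁ k) (Star⇒TransClosure (proj₁ k′) (Star.gmap id proj₁ ks))

module _ {A B : Set} where

  IsFinite-↔ : A ↔ B → IsFinite B → IsFinite A
  IsFinite-↔ A↔B (n , B↔Fin) = n , ↔-trans A↔B B↔Fin

  IsFinite-⊎ : IsFinite A → IsFinite B → IsFinite (A ⊎ B)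
  IsFinite-⊎ (m , A↔Fin) (n , B↔Fin) = m + n , ↔-trans (A↔Fin ⊎-↔ B↔Fin) (↔-sym Fin.+↔⊎)

≡true↔Fin : (b : Bool) → (b ≡ true) ↔ Fin (if b then 1 else 0)
≡true↔Fin true  = mk↔ₛ′ (λ _ → zero) (λ _ → refl) (λ { zero → refl ; (suc ()) }) (λ { refl → refl })
≡true↔Fin false = mk↔ₛ′ (λ ()) (λ ()) (λ ()) (λ ())

Σ-Fin-suc-↔ : ∀ {n} {P : Fin (suc n) → Set} → Σ (Fin (suc n)) P ↔ (P zero ⊎ Σ (Fin n) (P ∘ suc))
Σ-Fin-suc-↔ {P = P} = mk↔ₛ′ split join (λ { (inj₁ _) → refl ; (inj₂ _) → refl })
                                       (λ { (zero , _) → refl ; (suc _ , _) → refl })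
  where
  split : Σ _ P → P zero ⊎ Σ _ (P ∘ suc)
  split (zero  , p) = inj₁ p
  split (suc i , p) = inj₂ (i , p)
  join : P zero ⊎ Σ _ (P ∘ suc) → Σ _ P
  join (inj₁ p)       = zero , p
  join (inj₂ (i , p)) = suc i , p

Fin-subset-finite : ∀ n (P : Fin n → Bool) → IsFinite (Σ (Fin n) λ i → P i ≡ true)
Fin-subset-finite ℕ.zero P = 0 , mk↔ₛ′ (λ { (() , _) }) (λ ()) (λ ()) (λ { (() , _) })
Fin-subset-finite (suc n) P = IsFinite-↔ Σ-Fin-suc-↔
  (IsFinite-⊎ (_ , ≡true↔Fin (P zero)) (Fin-subset-finite n (P ∘ suc)))

subset-finite : {A : Set} → IsFinite A → (P : A → Bool) → IsFinite (Σ A λ a → P a ≡ true)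
subset-finite (n , J) P = IsFinite-↔
  (Σ-↔ J λ {a} → K-reflexive (cong (λ b → P b ≡ true) (sym (Inverse.strictlyInverseʳ J a))))
  (Fin-subset-finite n (P ∘ Inverse.from J))

module _ {A : Set} {R : A → A → Set} (rank : A → ℕ)
         (ascending : ∀ {x y} → R x y → rank x ℕ.< rank y) where

  ascending⁺ : ∀ {x y} → TransClosure R x y → rank x ℕ.< rank y
  ascending⁺ [ r ]    = ascending r
  ascending⁺ (r ∷ rs) = ℕ.<-trans (ascending r) (ascending⁺ rs)

  ascending⇒acyclic : Acyclic R
  ascending⇒acyclic x cycle = ℕ.<-irrefl refl (ascending⁺ cycle)

  ascending⇒wellFounded : (bound : ℕ) → (∀ x → rank x ℕ.≤ bound) → WellFounded (flip R)
  ascending⇒wellFounded bound bounded = Subrelation.wellFounded descends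
    (On.wellFounded (λ x → bound ∸ rank x) <-wellFounded)
    where
    descends : ∀ {y x} → R x y → bound ∸ rank y ℕ.< bound ∸ rank x
    descends {y} r = ℕ.∸-monoʳ-< (ascending r) (bounded y)

suc-double-< : ∀ {a b} → a ℕ.< b → suc (2 * a) ℕ.< 2 * b
suc-double-< {a} {b} a<b = subst (ℕ._≤ 2 * b) (ℕ.*-suc 2 a) (ℕ.*-monoʳ-≤ 2 a<b)

Fin-maximum : ∀ {n} → Fin n → Σ (Fin n) λ t → (j : Fin n) → j Fin.≤ t
Fin-maximum {suc k} _ = Fin.fromℕ k , Fin.≤fromℕ

module _ {W : Set} {D : LDigraph W} (π : TopOrd D) where

  private
    pos = Inverse.to (ord π)

  -- The π-last node has no out-arcs, so it is the unique sink.
  uniqueSink-last : (s : node D) → (∀ w → IsSink D w → w ≡ s) → ∀ u → pos u Fin.≤ pos s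
  uniqueSink-last s unique u = subst (pos u Fin.≤_) t≡pos-s (maximal (pos u))
    where
    t = proj₁ (Fin-maximum (pos s))
    maximal = proj₂ (Fin-maximum (pos s))
    pos-last : pos (Inverse.from (ord π) t) ≡ t
    pos-last = Inverse.strictlyInverseˡ (ord π) t
    last-isSink : IsSink D (Inverse.from (ord π) t)
    last-isSink w a = ℕ.<⇒≱ (subst (Fin._< pos w) pos-last (resp π _ w a)) (maximal (pos w))
    t≡pos-s : t ≡ pos s
    t≡pos-s = trans (sym pos-last) (cong pos (unique _ last-isSink))

module _ {W : Set} {D₁ D₂ : LDigraph W} (I : Iso D₁ D₂) where

  private
    to   = Inverse.to (Iso.φ I)
    from = Inverse.from (Iso.φ I)

  Iso-sym : Iso D₂ D₁
  Iso-sym = record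
    { φ       = ↔-sym (Iso.φ I)
    ; arcPres = λ u v → mk⇔
        (λ a → Equivalence.from (Iso.arcPres I (from u) (from v))
                 (subst₂ (arc D₂) (sym (to∘from u)) (sym (to∘from v)) a))
        (λ a → subst₂ (arc D₂) (to∘from u) (to∘from v) (Equivalence.to (Iso.arcPres I _ _) a))
    ; labPres = λ u → trans (sym (Iso.labPres I (from u))) (cong (lab D₂) (to∘from u))
    }
    where to∘from = Inverse.strictlyInverseˡ (Iso.φ I)

  NoDetour-Iso : ∀ {x y} → NoDetour (arc D₁) x y → NoDetour (arc D₂) (to x) (to y)
  NoDetour-Iso {x} {y} noDetour z a t = noDetour (from z)
    (subst (λ x′ → arc D₁ x′ (from z)) (from∘to x) (arc⁻ a))
    (subst (TransClosure (arc D₁) (from z)) (from∘to y) (map⁺ arc⁻ t))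
    where
    from∘to = Inverse.strictlyInverseʳ (Iso.φ I)
    arc⁻ : ∀ {u v} → arc D₂ u v → arc D₁ (from u) (from v)
    arc⁻ = Equivalence.to (Iso.arcPres Iso-sym _ _)

≢-opposite : {a b c d : Bool} → a ≢ b → a ≢ c → b ≢ d → c ≢ d
≢-opposite a≢b a≢c b≢d c≡d =
  a≢b (not-injective (trans (sym (¬-not (a≢c ∘ sym))) (trans c≡d (¬-not (b≢d ∘ sym)))))

isInj₁ : {A B : Set} → A ⊎ B → Bool
isInj₁ (inj₁ _) = true
isInj₁ (inj₂ _) = false

findFin-complete : ∀ {n} (P : Fin n → Bool) {i} → P i ≡ true →
                   ∃[ j ] findFin P ≡ just j × P j ≡ true
findFin-complete {suc n} P {i} Pi with P zero in P0
... | true = zero , refl , P0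
findFin-complete {suc n} P {zero}  Pi | false with () ← trans (sym P0) Pi
findFin-complete {suc n} P {suc i} Pi | false with findFin-complete (P ∘ suc) Pi
... | j , found , Pj = suc j , cong (Maybe.map suc) found , Pj

isUp isDown : {m : ℕ} → Lab m → Bool
isUp (up _) = true
isUp _      = false
isDown (down _) = true
isDown _        = false

isDown⇒¬isUp : ∀ {m} (l : Lab m) → isDown l ≡ true → isUp l ≢ true
isDown⇒¬isUp (down _) _ ()

SameOrAdj : {W : Set} → Graph W → W → W → Set
SameOrAdj G x y = x ≡ y ⊎ Adj G x y

module _ {m : ℕ} (M : Fin m → Fin m → Bool) where

  record TwinArc (Dg : LDigraph (Lab m)) (x y : node Dg) : Set where
    field
      twin     : arc Dg x y
      covering : NoDetour (arc Dg) x y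
      headDown : isDown (lab Dg y) ≡ true
      partners : M (base (lab Dg x)) (base (lab Dg y)) ≡ true

  TwinArc-Iso : ∀ {D₁ D₂} (I : Iso D₁ D₂) {x y} → TwinArc D₁ x y →
                TwinArc D₂ (Inverse.to (Iso.φ I) x) (Inverse.to (Iso.φ I) y)
  TwinArc-Iso I {x} {y} t = record
    { twin     = Equivalence.to (Iso.arcPres I x y) twin
    ; covering = NoDetour-Iso I covering
    ; headDown = subst (λ l → isDown l ≡ true) (sym (Iso.labPres I y)) headDown
    ; partners = subst₂ (λ a b → M (base a) (base b) ≡ true)
                   (sym (Iso.labPres I x)) (sym (Iso.labPres I y)) partners
    }
    where open TwinArc t

module Construction {m : ℕ} {E M : Fin m → Fin m → Bool}
  (E-sym : ∀ i j → E i j ≡ E j i) (E-irrefl : ∀ i → E i i ≡ false) (matching : IsMatching E M) where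

  private
    M⇒E = IsMatching.sub matching
    M-sym = IsMatching.sym matching
    M-functional = IsMatching.match matching

  SameOrAdj-base : ∀ {x y} → SameOrAdj (GM E M) x y → SameOrAdj (GD E) (base x) (base y)
  SameOrAdj-base (inj₁ refl) = inj₁ refl
  SameOrAdj-base (inj₂ (_ , _ , _ , _ , _ , e , bx , by)) with bx | by
  ... | inj₁ p    | inj₁ q    = inj₁ (trans p (sym q))
  ... | inj₂ p    | inj₂ q    = inj₁ (trans p (sym q))
  ... | inj₁ refl | inj₂ refl = inj₂ e
  ... | inj₂ refl | inj₁ refl = inj₂ (trans (E-sym _ _) e)

  SameOrAdj-sym : ∀ {x y} → SameOrAdj (GM E M) x y → SameOrAdj (GM E M) y x
  SameOrAdj-sym (inj₁ refl) = inj₁ refl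
  SameOrAdj-sym (inj₂ (x≢y , inx , iny , i₀ , i₁ , e , bx , by)) =
    inj₂ ((λ y≡x → x≢y (sym y≡x)) , iny , inx , i₀ , i₁ , e , by , bx)

  -- Distinct vertices of G^M over one vertex i of G_D can only be i↑ and i↓, which are adjacent.
  sameBase⇒SameOrAdj : ∀ x y → InVM M x → InVM M y → base x ≡ base y → SameOrAdj (GM E M) x y
  sameBase⇒SameOrAdj (plain _) (plain _) _   _   refl = inj₁ refl
  sameBase⇒SameOrAdj (up _)    (up _)    _   _   refl = inj₁ refl
  sameBase⇒SameOrAdj (down _)  (down _)  _   _   refl = inj₁ refl
  sameBase⇒SameOrAdj (plain _) (up _)    ¬mi mi  refl = ⊥-elim (¬mi mi)
  sameBase⇒SameOrAdj (plain _) (down _)  ¬mi mi  refl = ⊥-elim (¬mi mi)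
  sameBase⇒SameOrAdj (up _)    (plain _) mi  ¬mi refl = ⊥-elim (¬mi mi)
  sameBase⇒SameOrAdj (down _)  (plain _) mi  ¬mi refl = ⊥-elim (¬mi mi)
  sameBase⇒SameOrAdj (up i)    (down _)  mi  mi′ refl =
    inj₂ ((λ ()) , mi , mi′ , i , proj₁ mi , M⇒E _ _ (proj₂ mi) , inj₁ refl , inj₁ refl)
  sameBase⇒SameOrAdj (down i)  (up _)    mi  mi′ refl =
    inj₂ ((λ ()) , mi , mi′ , i , proj₁ mi , M⇒E _ _ (proj₂ mi) , inj₁ refl , inj₁ refl)

  SameOrAdj-lift : ∀ {x y} → InVM M x → InVM M y →
                   SameOrAdj (GD E) (base x) (base y) → SameOrAdj (GM E M) x y
  SameOrAdj-lift inx iny (inj₁ eq) = sameBase⇒SameOrAdj _ _ inx iny eq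
  SameOrAdj-lift {x} {y} inx iny (inj₂ e) =
    inj₂ (x≢y , inx , iny , base x , base y , e , inj₁ refl , inj₂ refl)
    where
    x≢y : x ≢ y
    x≢y refl with () ← trans (sym e) (E-irrefl (base x))

  module Image (D : LDigraph (Fin m)) (π : TopOrd D) (S : Quad (node D))
               (proper : IsProperWdag (GD E) D) (inψ : InPsi M D S) where

    open InPsi inψ

    H : LDigraph (Lab m)
    H = h E M D π S

    private
      L = lab D
      ℓ = hLab M D S
      pos = Inverse.to (ord π)
      wdag = IsProperWdag.wdag proper

    X : node D → Bool
    X v = S₃ S v ∨ S₄ S v

    -- Indexed by the four membership bits, so that matching on classify v pins S₁ S v, …, S₄ S v.
    data Class (v : node D) : Bool → Bool → Bool → Bool → Set where
      in₁ : Matched M (L v) → Class v true  false false false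
      in₂ : Matched M (L v) → Class v false true  false false
      in₃ : Matched M (L v) → Class v false false true  false
      in₄ : Matched M (L v) → Class v false false false true
      out : ¬ Matched M (L v) → Class v false false false false

    classify : ∀ v → Class v (S₁ S v) (S₂ S v) (S₃ S v) (S₄ S v)
    classify v with S₁ S v in e₁ | S₂ S v in e₂ | S₃ S v in e₃ | S₄ S v in e₄ | union v
    ... | true  | false | false | false | u = in₁ (Equivalence.to u refl)
    ... | false | true  | false | false | u = in₂ (Equivalence.to u refl)
    ... | false | false | true  | false | u = in₃ (Equivalence.to u refl)
    ... | false | false | false | true  | u = in₄ (Equivalence.to u refl)
    ... | false | false | false | false | u = out (λ mv → case Equivalence.from u mv of λ ())
    ... | true  | true  | _     | _     | _ = ⊥-elim (d12 v e₁ e₂)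
    ... | true  | _     | true  | _     | _ = ⊥-elim (d13 v e₁ e₃)
    ... | true  | _     | _     | true  | _ = ⊥-elim (d14 v e₁ e₄)
    ... | _     | true  | true  | _     | _ = ⊥-elim (d23 v e₂ e₃)
    ... | _     | true  | _     | true  | _ = ⊥-elim (d24 v e₂ e₄)
    ... | _     | _     | true  | true  | _ = ⊥-elim (d34 v e₃ e₄)

    f-labIn : ∀ v → InVM M (ℓ (inj₁ v))
    f-labIn v with S₁ S v | S₂ S v | S₃ S v | S₄ S v | classify v
    ... | _ | _ | _ | _ | in₁ mv  = mv
    ... | _ | _ | _ | _ | in₂ mv  = mv
    ... | _ | _ | _ | _ | in₃ mv  = mv
    ... | _ | _ | _ | _ | in₄ mv  = mv
    ... | _ | _ | _ | _ | out ¬mv = ¬mv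

    f-base : ∀ v → base (ℓ (inj₁ v)) ≡ L v
    f-base v with S₁ S v | S₂ S v ∨ X v
    ... | true  | _     = refl
    ... | false | true  = refl
    ... | false | false = refl

    f-isUp : ∀ v → isUp (ℓ (inj₁ v)) ≡ S₁ S v
    f-isUp v with S₁ S v | S₂ S v ∨ X v
    ... | true  | _     = refl
    ... | false | true  = refl
    ... | false | false = refl

    S₂-decode : ∀ v → S₂ S v ≡ isDown (ℓ (inj₁ v)) ∧ not (X v)
    S₂-decode v with S₁ S v | S₂ S v | S₃ S v | S₄ S v | classify v
    ... | _ | _ | _ | _ | in₁ _ = refl
    ... | _ | _ | _ | _ | in₂ _ = refl
    ... | _ | _ | _ | _ | in₃ _ = refl
    ... | _ | _ | _ | _ | in₄ _ = refl
    ... | _ | _ | _ | _ | out _ = refl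

    S₃-outside : ∀ v → X v ≡ false → S₃ S v ≡ false
    S₃-outside v with S₃ S v
    ... | true  = λ ()
    ... | false = λ _ → refl

    S₄-decode : ∀ v → S₄ S v ≡ X v ∧ not (S₃ S v)
    S₄-decode v with S₁ S v | S₂ S v | S₃ S v | S₄ S v | classify v
    ... | _ | _ | _ | _ | in₁ _ = refl
    ... | _ | _ | _ | _ | in₂ _ = refl
    ... | _ | _ | _ | _ | in₃ _ = refl
    ... | _ | _ | _ | _ | in₄ _ = refl
    ... | _ | _ | _ | _ | out _ = refl

    X-matched : ∀ v → X v ≡ true → Matched M (L v)
    X-matched v with S₁ S v | S₂ S v | S₃ S v | S₄ S v | classify v
    ... | _ | _ | _ | _ | in₃ mv = λ _ → mv
    ... | _ | _ | _ | _ | in₄ mv = λ _ → mv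
    ... | _ | _ | _ | _ | in₁ _  = λ ()
    ... | _ | _ | _ | _ | in₂ _  = λ ()
    ... | _ | _ | _ | _ | out _  = λ ()

    X⇒f-down : ∀ v → X v ≡ true → isDown (ℓ (inj₁ v)) ≡ true
    X⇒f-down v with S₁ S v | S₂ S v | S₃ S v | S₄ S v | classify v
    ... | _ | _ | _ | _ | in₃ _ = λ _ → refl
    ... | _ | _ | _ | _ | in₄ _ = λ _ → refl
    ... | _ | _ | _ | _ | in₁ _ = λ ()
    ... | _ | _ | _ | _ | in₂ _ = λ ()
    ... | _ | _ | _ | _ | out _ = λ ()

    partner : ∀ v (Xv : X v ≡ true) →
              ∃[ j ] M (L v) j ≡ true × ℓ (inj₂ (v , Xv)) ≡ (if S₃ S v then up j else down j)
    partner v Xv with findFin-complete (M (L v)) (proj₂ (X-matched v Xv))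
    ... | j , found , Mj rewrite found = j , Mj , refl

    f*-over-partner : ∀ v Xv → M (L v) (base (ℓ (inj₂ (v , Xv)))) ≡ true
    f*-over-partner v Xv with partner v Xv
    ... | j , Mj , label rewrite label with S₃ S v
    ...   | true  = Mj
    ...   | false = Mj

    f*-isUp : ∀ v Xv → isUp (ℓ (inj₂ (v , Xv))) ≡ S₃ S v
    f*-isUp v Xv with partner v Xv
    ... | j , _ , label rewrite label with S₃ S v
    ...   | true  = refl
    ...   | false = refl

    labIn : ∀ x → InVM M (ℓ x)
    labIn (inj₁ v) = f-labIn v
    labIn (inj₂ (v , Xv)) with partner v Xv
    ... | j , Mj , label rewrite label with S₃ S v
    ...   | true  = L v , M-sym _ _ Mj
    ...   | false = L v , M-sym _ _ Mj

    private
      g = hg S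

    related : ∀ x y → SameOrAdj (GD E) (base (ℓ x)) (base (ℓ y)) → SameOrAdj (GM E M) (ℓ x) (ℓ y)
    related x y = SameOrAdj-lift (labIn x) (labIn y)

    lift-arc : ∀ {u v} → arc D u v → arc H (inj₁ u) (inj₁ v)
    lift-arc {u} {v} a = inj₂ (related (inj₁ u) (inj₁ v) labels , resp π u v a)
      where
      u≢v : u ≢ v
      u≢v refl = IsWdag.acyclic wdag u [ a ]
      labels = subst₂ (SameOrAdj (GD E)) (sym (f-base u)) (sym (f-base v))
                 (Equivalence.to (IsWdag.arcIff wdag u v u≢v) (inj₁ a))

    lower-arc : ∀ {u v} → arc H (inj₁ u) (inj₁ v) → arc D u v
    lower-arc {u} {v} (inj₂ (rel , u≺v)) with Equivalence.from (IsWdag.arcIff wdag u v u≢v) labels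
      where
      u≢v : u ≢ v
      u≢v refl = Fin.<-irrefl refl u≺v
      labels = subst₂ (SameOrAdj (GD E)) (f-base u) (f-base v) (SameOrAdj-base rel)
    ... | inj₁ a = a
    ... | inj₂ a = ⊥-elim (ℕ.<-asym u≺v (resp π v u a))

    rank : hNode S → ℕ
    rank (inj₁ v)       = suc (2 * toℕ (pos v))
    rank (inj₂ (v , _)) = 2 * toℕ (pos v)

    rank≤ : ∀ x → rank x ℕ.≤ suc (2 * toℕ (pos (g x)))
    rank≤ (inj₁ _) = ℕ.≤-refl
    rank≤ (inj₂ _) = ℕ.n≤1+n _

    ≤rank : ∀ x → 2 * toℕ (pos (g x)) ℕ.≤ rank x
    ≤rank (inj₁ _) = ℕ.n≤1+n _
    ≤rank (inj₂ _) = ℕ.≤-refl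

    rank-arc : ∀ {x y} → arc H x y → rank x ℕ.< rank y
    rank-arc {inj₂ (v , _)} {inj₁ _} (inj₁ refl) = ℕ.n<1+n _
    rank-arc {x} {y} (inj₂ (_ , gx≺gy)) =
      ℕ.≤-trans (s≤s (rank≤ x)) (ℕ.≤-trans (suc-double-< gx≺gy) (≤rank y))

    rank-bounded : ∀ x → rank x ℕ.≤ 2 * size π
    rank-bounded x = ℕ.≤-trans (rank≤ x) (ℕ.<⇒≤ (suc-double-< (Fin.toℕ<n (pos (g x)))))

    arc⇒related : ∀ {x y} → arc H x y → SameOrAdj (GM E M) (ℓ x) (ℓ y)
    arc⇒related {inj₁ _}        {_}      (inj₁ ())
    arc⇒related {inj₂ _}        {inj₂ _} (inj₁ ())
    arc⇒related {inj₂ (v , Xv)} {inj₁ _} (inj₁ refl) = related (inj₂ (v , Xv)) (inj₁ v)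
      (inj₂ (subst (λ i → E (base (ℓ (inj₂ (v , Xv)))) i ≡ true) (sym (f-base v))
                   (M⇒E _ _ (M-sym _ _ (f*-over-partner v Xv)))))
    arc⇒related (inj₂ (rel , _)) = rel

    sameNode-arc : ∀ x y → g x ≡ g y → x ≢ y → arc H x y ⊎ arc H y x
    sameNode-arc (inj₁ _)       (inj₁ _)       refl x≢y = ⊥-elim (x≢y refl)
    sameNode-arc (inj₁ _)       (inj₂ _)       eq   _   = inj₂ (inj₁ (sym eq))
    sameNode-arc (inj₂ _)       (inj₁ _)       eq   _   = inj₁ (inj₁ eq)
    sameNode-arc (inj₂ (_ , p)) (inj₂ (_ , q)) refl x≢y =
      ⊥-elim (x≢y (cong (λ p → inj₂ (_ , p)) (Decidable⇒UIP.≡-irrelevant Bool._≟_ p q)))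

    arcIff : ∀ x y → x ≢ y → (arc H x y ⊎ arc H y x) ⇔ SameOrAdj (GM E M) (ℓ x) (ℓ y)
    arcIff x y x≢y = mk⇔ [ arc⇒related , SameOrAdj-sym ∘ arc⇒related ]′ related⇒arc
      where
      related⇒arc : SameOrAdj (GM E M) (ℓ x) (ℓ y) → arc H x y ⊎ arc H y x
      related⇒arc rel with Fin.<-cmp (pos (g x)) (pos (g y))
      ... | tri< x≺y _ _ = inj₁ (inj₂ (rel , x≺y))
      ... | tri≈ _ eq _  = sameNode-arc x y (Injection.injective (↔⇒↣ (ord π)) eq) x≢y
      ... | tri> _ _ y≺x = inj₂ (inj₂ (SameOrAdj-sym rel , y≺x))

    sink : node D
    sink = IsProperWdag.sink proper

    f-sink-isSink : IsSink H (inj₁ sink)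
    f-sink-isSink y (inj₂ (_ , s≺gy)) =
      ℕ.<⇒≱ s≺gy (uniqueSink-last π sink (IsProperWdag.unique proper) (g y))

    f-sink-unique : ∀ w → IsSink H w → w ≡ inj₁ sink
    f-sink-unique (inj₂ (v , _)) isSink = ⊥-elim (isSink (inj₁ v) (inj₁ refl))
    f-sink-unique (inj₁ v)       isSink =
      cong inj₁ (IsProperWdag.unique proper v (λ u a → isSink (inj₁ u) (lift-arc a)))

    h-proper : IsProperWdag (GM E M) H
    h-proper = record
      { wdag    = record
        { finite  = IsFinite-⊎ (size π , ord π) (subset-finite (size π , ord π) X)
        ; acyclic = ascending⇒acyclic rank rank-arc
        ; labIn   = labIn
        ; arcIff  = arcIff
        }
      ; sink    = inj₁ sink
      ; isSink  = f-sink-isSink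
      ; unique  = f-sink-unique
      }

    arc⁻¹-wellFounded : WellFounded (flip (arc H))
    arc⁻¹-wellFounded = ascending⇒wellFounded rank rank-arc (2 * size π) rank-bounded

    twinArc : ∀ v Xv → TwinArc M H (inj₂ (v , Xv)) (inj₁ v)
    twinArc v Xv = record
      { twin     = inj₁ refl
      ; covering = λ z a path → ℕ.<⇒≱ (rank-arc a) (ℕ.s≤s⁻¹ (ascending⁺ rank rank-arc path))
      ; headDown = X⇒f-down v Xv
      ; partners = subst (λ i → M (base (ℓ (inj₂ (v , Xv)))) i ≡ true) (sym (f-base v))
                         (M-sym _ _ (f*-over-partner v Xv))
      }

    -- Such an arc of D would be M-reversible, forcing v ∈ 𝒱(D) ⊆ 𝒮₁, so f(v) would be labelled ↑.
    noTwinArc-f-f : ∀ w v → ¬ TwinArc M H (inj₁ w) (inj₁ v)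
    noTwinArc-f-f w v t =
      isDown⇒¬isUp (ℓ (inj₁ v)) headDown (trans (f-isUp v) (V⊆S₁ v (w , inj₂ reversible)))
      where
      open TwinArc t
      wv : arc D w v
      wv = lower-arc twin
      noDetour : NoDetour (arc D) w v
      noDetour z a path = covering (inj₁ z) (lift-arc a) (map⁺ lift-arc path)
      reversible : Reversible M D w v
      reversible = wv , reverseArc-acyclic (IsWdag.acyclic wdag) wv noDetour
                 , subst₂ (λ i j → M i j ≡ true) (f-base w) (f-base v) partners

    -- Were the arc in E₂′, the label of y would lie over L u, so f(u) → y would be a detour.
    twinArc-from-f* : ∀ {u Xu y} → TwinArc M H (inj₂ (u , Xu)) y → y ≡ inj₁ u
    twinArc-from-f* {u} {Xu} {y} t with TwinArc.twin t
    ... | inj₁ e = E₁-target y e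
      where
      E₁-target : ∀ y → hE₁ S (inj₂ (u , Xu)) y → y ≡ inj₁ u
      E₁-target (inj₁ _) refl = refl
    ... | inj₂ (_ , u≺gy) =
      ⊥-elim (covering (inj₁ u) (inj₁ refl) [ inj₂ (related (inj₁ u) y (inj₁ same) , u≺gy) ])
      where
      open TwinArc t
      same : base (ℓ (inj₁ u)) ≡ base (ℓ y)
      same = trans (f-base u)
                   (sym (M-functional _ _ _ partners (M-sym _ _ (f*-over-partner u Xu))))

    twinArc-crosses : ∀ {x y} → TwinArc M H x y → isInj₁ x ≢ isInj₁ y
    twinArc-crosses {inj₁ w} {inj₁ v} t _ = noTwinArc-f-f w v t
    twinArc-crosses {inj₁ _} {inj₂ _} _ ()
    twinArc-crosses {inj₂ _}          t with refl ← twinArc-from-f* t = λ ()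

    twinArc-from-V₂ : ∀ x → isInj₁ x ≡ false → ∃[ y ] TwinArc M H x y
    twinArc-from-V₂ (inj₂ (v , Xv)) _ = inj₁ v , twinArc v Xv

  module Restrict
    (D₁ : LDigraph (Fin m)) (π₁ : TopOrd D₁) (S : Quad (node D₁))
    (proper₁ : IsProperWdag (GD E) D₁) (inψ₁ : InPsi M D₁ S)
    (D₂ : LDigraph (Fin m)) (π₂ : TopOrd D₂) (T : Quad (node D₂))
    (proper₂ : IsProperWdag (GD E) D₂) (inψ₂ : InPsi M D₂ T)
    (I : Iso (h E M D₁ π₁ S) (h E M D₂ π₂ T)) where

    module A = Image D₁ π₁ S proper₁ inψ₁
    module B = Image D₂ π₂ T proper₂ inψ₂

    private
      to   = Inverse.to (Iso.φ I)
      from = Inverse.from (Iso.φ I)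

    Swapped : hNode S → Set
    Swapped x = isInj₁ x ≢ isInj₁ (to x)

    twinArc-out : ∀ {x} → Swapped x → ∃[ y ] TwinArc M A.H x y
    twinArc-out {x} swapped with isInj₁ x in x∈V₂
    ... | false = A.twinArc-from-V₂ x x∈V₂
    ... | true with B.twinArc-from-V₂ (to x) (¬-not (swapped ∘ sym))
    ...   | y′ , t = from y′ , subst (λ z → TwinArc M A.H z (from y′))
                                     (Inverse.strictlyInverseʳ (Iso.φ I) x)
                                     (TwinArc-Iso M (Iso-sym I) t)

    swapped-ascends : ∀ {x} → Swapped x → ∃[ y ] arc A.H x y × Swapped y
    swapped-ascends swapped with twinArc-out swapped
    ... | y , t = y , TwinArc.twin t
                , ≢-opposite swapped (A.twinArc-crosses t) (B.twinArc-crosses (TwinArc-Iso M I t))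

    sides-preserved : ∀ x → isInj₁ (to x) ≡ isInj₁ x
    sides-preserved x = decidable-stable (isInj₁ (to x) Bool.≟ isInj₁ x)
      λ ne → descent∧wf⇒empty swapped-ascends A.arc⁻¹-wellFounded x (ne ∘ sym)

    to-f : ∀ v → ∃[ w ] to (inj₁ v) ≡ inj₁ w
    to-f v with to (inj₁ v) | sides-preserved (inj₁ v)
    ... | inj₁ w | _ = w , refl

    ψ : node D₁ → node D₂
    ψ v = proj₁ (to-f v)

    to-f≡ : ∀ v → to (inj₁ v) ≡ inj₁ (ψ v)
    to-f≡ v = proj₂ (to-f v)

    to-f* : ∀ v Xv → Σ (B.X (ψ v) ≡ true) λ Xψv → to (inj₂ (v , Xv)) ≡ inj₂ (ψ v , Xψv)
    to-f* v Xv with to (inj₂ (v , Xv)) in eq | sides-preserved (inj₂ (v , Xv))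
    ... | inj₂ (w , Xw) | _
      with refl ← inj₁-injective (B.twinArc-from-f*
                    (subst₂ (TwinArc M B.H) eq (to-f≡ v) (TwinArc-Iso M I (A.twinArc v Xv))))
      = Xw , refl

    f-label : ∀ v → lab B.H (inj₁ (ψ v)) ≡ lab A.H (inj₁ v)
    f-label v = trans (cong (lab B.H) (sym (to-f≡ v))) (Iso.labPres I (inj₁ v))

    f*-label : ∀ v Xv → lab B.H (inj₂ (ψ v , proj₁ (to-f* v Xv))) ≡ lab A.H (inj₂ (v , Xv))
    f*-label v Xv =
      trans (cong (lab B.H) (sym (proj₂ (to-f* v Xv)))) (Iso.labPres I (inj₂ (v , Xv)))

    ψ-lab : ∀ v → lab D₂ (ψ v) ≡ lab D₁ v
    ψ-lab v = trans (sym (B.f-base (ψ v))) (trans (cong base (f-label v)) (A.f-base v))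

    ψ-arc : ∀ {u v} → arc D₁ u v → arc D₂ (ψ u) (ψ v)
    ψ-arc {u} {v} a = B.lower-arc
      (subst₂ (arc B.H) (to-f≡ u) (to-f≡ v) (Equivalence.to (Iso.arcPres I _ _) (A.lift-arc a)))

    ψ-arc⁻¹ : ∀ {u v} → arc D₂ (ψ u) (ψ v) → arc D₁ u v
    ψ-arc⁻¹ {u} {v} b = A.lower-arc
      (Equivalence.from (Iso.arcPres I _ _)
        (subst₂ (arc B.H) (sym (to-f≡ u)) (sym (to-f≡ v)) (B.lift-arc b)))

  module Recover
    (D₁ : LDigraph (Fin m)) (π₁ : TopOrd D₁) (S : Quad (node D₁))
    (proper₁ : IsProperWdag (GD E) D₁) (inψ₁ : InPsi M D₁ S)
    (D₂ : LDigraph (Fin m)) (π₂ : TopOrd D₂) (T : Quad (node D₂))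
    (proper₂ : IsProperWdag (GD E) D₂) (inψ₂ : InPsi M D₂ T)
    (I : Iso (h E M D₁ π₁ S) (h E M D₂ π₂ T)) where

    open Restrict D₁ π₁ S proper₁ inψ₁ D₂ π₂ T proper₂ inψ₂ I
    module Inv = Restrict D₂ π₂ T proper₂ inψ₂ D₁ π₁ S proper₁ inψ₁ (Iso-sym I)

    private
      to   = Inverse.to (Iso.φ I)
      from = Inverse.from (Iso.φ I)
    open ≡-Reasoning

    ψ⁻¹∘ψ : ∀ v → Inv.ψ (ψ v) ≡ v
    ψ⁻¹∘ψ v = inj₁-injective (begin
      inj₁ (Inv.ψ (ψ v))  ≡⟨ sym (Inv.to-f≡ (ψ v)) ⟩
      from (inj₁ (ψ v))   ≡⟨ cong from (sym (to-f≡ v)) ⟩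
      from (to (inj₁ v))  ≡⟨ Inverse.strictlyInverseʳ (Iso.φ I) (inj₁ v) ⟩
      inj₁ v              ∎)

    ψ∘ψ⁻¹ : ∀ w → ψ (Inv.ψ w) ≡ w
    ψ∘ψ⁻¹ w = inj₁-injective (begin
      inj₁ (ψ (Inv.ψ w))   ≡⟨ sym (to-f≡ (Inv.ψ w)) ⟩
      to (inj₁ (Inv.ψ w))  ≡⟨ cong to (sym (Inv.to-f≡ w)) ⟩
      to (from (inj₁ w))   ≡⟨ Inverse.strictlyInverseˡ (Iso.φ I) (inj₁ w) ⟩
      inj₁ w               ∎)

    X-preserved : ∀ v → B.X (ψ v) ≡ A.X v
    X-preserved v = ⇔→≡ (mk⇔ backward (proj₁ ∘ to-f* v))
      where
      backward : B.X (ψ v) ≡ true → A.X v ≡ true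
      backward Xψv = subst (λ u → A.X u ≡ true) (ψ⁻¹∘ψ v) (proj₁ (Inv.to-f* (ψ v) Xψv))

    S₁-preserved : ∀ v → S₁ T (ψ v) ≡ S₁ S v
    S₁-preserved v = begin
      S₁ T (ψ v)                   ≡⟨ B.f-isUp (ψ v) ⟨
      isUp (lab B.H (inj₁ (ψ v)))  ≡⟨ cong isUp (f-label v) ⟩
      isUp (lab A.H (inj₁ v))      ≡⟨ A.f-isUp v ⟩
      S₁ S v                       ∎

    S₂-preserved : ∀ v → S₂ T (ψ v) ≡ S₂ S v
    S₂-preserved v = begin
      S₂ T (ψ v)
        ≡⟨ B.S₂-decode (ψ v) ⟩
      isDown (lab B.H (inj₁ (ψ v))) ∧ not (B.X (ψ v))
        ≡⟨ cong₂ (λ l b → isDown l ∧ not b) (f-label v) (X-preserved v) ⟩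
      isDown (lab A.H (inj₁ v)) ∧ not (A.X v)
        ≡⟨ A.S₂-decode v ⟨
      S₂ S v
        ∎

    S₃-preserved : ∀ v → S₃ T (ψ v) ≡ S₃ S v
    S₃-preserved v with A.X v in Xv
    ... | true  = begin
      S₃ T (ψ v)                                   ≡⟨ B.f*-isUp (ψ v) Xψv ⟨
      isUp (lab B.H (inj₂ (ψ v , Xψv)))            ≡⟨ cong isUp (f*-label v Xv) ⟩
      isUp (lab A.H (inj₂ (v , Xv)))               ≡⟨ A.f*-isUp v Xv ⟩
      S₃ S v                                       ∎
      where Xψv = proj₁ (to-f* v Xv)
    ... | false = trans (B.S₃-outside (ψ v) (trans (X-preserved v) Xv)) (sym (A.S₃-outside v Xv))

    S₄-preserved : ∀ v → S₄ T (ψ v) ≡ S₄ S v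
    S₄-preserved v = begin
      S₄ T (ψ v)
        ≡⟨ B.S₄-decode (ψ v) ⟩
      B.X (ψ v) ∧ not (S₃ T (ψ v))
        ≡⟨ cong₂ (λ b c → b ∧ not c) (X-preserved v) (S₃-preserved v) ⟩
      A.X v ∧ not (S₃ S v)
        ≡⟨ A.S₄-decode v ⟨
      S₄ S v
        ∎

    pairIso : PairIso D₁ D₂ S T
    pairIso = record
      { iso = record
        { φ       = mk↔ₛ′ ψ Inv.ψ ψ∘ψ⁻¹ ψ⁻¹∘ψ
        ; arcPres = λ u v → mk⇔ ψ-arc ψ-arc⁻¹
        ; labPres = ψ-lab
        }
      ; p₁ = S₁-preserved
      ; p₂ = S₂-preserved
      ; p₃ = S₃-preserved
      ; p₄ = S₄-preserved
      }

theorem3p10 : (m : ℕ) (E : Fin m → Fin m → Bool) →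
    (∀ i j → E i j ≡ E j i) → (∀ i → E i i ≡ false) →
    (M : Fin m → Fin m → Bool) → IsMatching E M →
    ((D : LDigraph (Fin m)) (π : TopOrd D) (S : Quad (node D)) →
       IsProperWdag (GD E) D → InPsi M D S →
       IsProperWdag (GM E M) (h E M D π S))
    ×
    ((D₁ : LDigraph (Fin m)) (π₁ : TopOrd D₁) (S : Quad (node D₁)) →
     (D₂ : LDigraph (Fin m)) (π₂ : TopOrd D₂) (T : Quad (node D₂)) →
       IsProperWdag (GD E) D₁ → InPsi M D₁ S →
       IsProperWdag (GD E) D₂ → InPsi M D₂ T →
       Iso (h E M D₁ π₁ S) (h E M D₂ π₂ T) → PairIso D₁ D₂ S T)
theorem3p10 m E E-sym E-irrefl M matching =
  (λ D π S proper inψ → Image.h-proper D π S proper inψ) ,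
  (λ D₁ π₁ S D₂ π₂ T proper₁ inψ₁ proper₂ inψ₂ I →
     Recover.pairIso D₁ π₁ S proper₁ inψ₁ D₂ π₂ T proper₂ inψ₂ I)
  where open Construction E-sym E-irrefl matching
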